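{- For every positive integer $n$, the integer $\{2\}$-domination number of the grid graph $G_{3,n}$ satisfies $$\gamma_{\{2\}}(G_{3,n}) \le \left\lfloor\frac{3n}{2}\right\rfloor + 1.$$
   Context: For positive integers $m,n$, the grid graph $G_{m,n}=P_m\square P_n$ has vertex set $\{v_{i,j}: 1\le i\le m,\ 1\le j\le n\}$, where $v_{i_1,j_1}v_{i_2,j_2}$ is an edge iff ($|i_1-i_2|=1$ and $j_1=j_2$) or ($i_1=i_2$ and $|j_1-j_2|=1$). For a graph $G=(V,E)$ and $v\in V$, $N[v]$ denotes the closed neighborhood of $v$. An integer $\{2\}$-dominating function of $G$ is a function $f:V\to\mathbb{Z}_{\ge 0}$ with $\sum_{y\in N[x]} f(y)\ge 2$ for every $x\in V$; the integer $\{2\}$-domination number $\gamma_{\{2\}}(G)$ is the minimum of $\sum_{x\in V} f(x)$ over all integer $\{2\}$-dominating functions $f$ of $G$. -}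

module Defs where

open import Data.Nat using (ℕ; zero; suc; _+_; _*_; _≤_; _/_)
open import Data.Fin using (Fin; toℕ)
open import Data.Product using (_×_; _,_; Σ)
open import Data.Sum using (_⊎_)
open import Relation.Binary.PropositionalEquality using (_≡_)
open import Relation.Nullary using (Dec; yes; no)
open import Relation.Nullary.Decidable using (_⊎-dec_; _×-dec_)
import Data.Nat.Properties as ℕP
import Data.Fin.Properties as FinP

∑ : (k : ℕ) → (Fin k → ℕ) → ℕ
∑ zero    f = 0
∑ (suc k) f = f Fin.zero + ∑ k (λ i → f (Fin.suc i))

record Graph : Set₁ where
  field
    order : ℕ
    Adj   : Fin order → Fin order → Set
    adj?  : (x y : Fin order) → Dec (Adj x y)

open Graph public

PathAdj : ∀ {k} → Fin k → Fin k → Set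
PathAdj a b = (suc (toℕ a) ≡ toℕ b) ⊎ (suc (toℕ b) ≡ toℕ a)

pathAdj? : ∀ {k} (a b : Fin k) → Dec (PathAdj a b)
pathAdj? a b = (suc (toℕ a) ℕP.≟ toℕ b) ⊎-dec (suc (toℕ b) ℕP.≟ toℕ a)

-- Vertex v_{i,j} (1 ≤ i ≤ m, 1 ≤ j ≤ n) is encoded as the pair (i-1, j-1),
-- and pairs are encoded in Fin (m * n) via Data.Fin's combine/remQuot.
GridAdj : (m n : ℕ) → Fin m × Fin n → Fin m × Fin n → Set
GridAdj m n (i₁ , j₁) (i₂ , j₂) = (PathAdj i₁ i₂ × j₁ ≡ j₂) ⊎ (i₁ ≡ i₂ × PathAdj j₁ j₂)

gridAdj? : (m n : ℕ) → (x y : Fin m × Fin n) → Dec (GridAdj m n x y)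
gridAdj? m n (i₁ , j₁) (i₂ , j₂) =
  (pathAdj? i₁ i₂ ×-dec (j₁ FinP.≟ j₂)) ⊎-dec ((i₁ FinP.≟ i₂) ×-dec pathAdj? j₁ j₂)

Grid : ℕ → ℕ → Graph
Grid m n = record
  { order = m * n
  ; Adj   = λ x y → GridAdj m n (Data.Fin.remQuot n x) (Data.Fin.remQuot n y)
  ; adj?  = λ x y → gridAdj? m n (Data.Fin.remQuot n x) (Data.Fin.remQuot n y)
  }

closedNbhdSum : (G : Graph) → (Fin (order G) → ℕ) → Fin (order G) → ℕ
closedNbhdSum G f x = ∑ (order G) (λ y → term y (y FinP.≟ x) (adj? G x y))
  where
  term : Fin (order G) → ∀ {P Q : Set} → Dec P → Dec Q → ℕ
  term y (yes _) _       = f y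
  term y (no _)  (yes _) = f y
  term y (no _)  (no _)  = 0

IsInt2DomFun : (G : Graph) → (Fin (order G) → ℕ) → Set
IsInt2DomFun G f = ∀ x → 2 ≤ closedNbhdSum G f x

weight : (G : Graph) → (Fin (order G) → ℕ) → ℕ
weight G f = ∑ (order G) f

-- γ_{{2}}(G) ≤ k : the minimum weight of an integer {2}-dominating function is ≤ k,
-- i.e. some integer {2}-dominating function has weight ≤ k.
γ₂-≤ : Graph → ℕ → Set
γ₂-≤ G k = Σ (Fin (order G) → ℕ) λ f → IsInt2DomFun G f × weight G f ≤ k

{-# OPTIONS --safe #-}
module Submission where

-- Number the columns 0, …, n.  Every cell of an odd column gets weight 1; the middle cell of
-- column 0 gets an extra 1, and so does the middle cell of column n when n is even.  A cell of
-- an odd column is 2-dominated by itself and a vertical neighbour; a cell of an even column by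
-- its horizontal neighbours, which lie in odd columns, a missing neighbour at a border column
-- being replaced by the extra weight in the middle of that column (for n = 0 both extras land
-- on the same cell).  If o of the N = n + 1 columns are odd, then 2 o + [N odd] = N and the
-- weight is 3 o + [N odd] + 1 ≤ ⌊3N/2⌋ + 1.

open import Defs
open import Data.Nat using (ℕ; zero; suc; _+_; _*_; _/_; _≤_; _<_; z≤n; s≤s; s<s⁻¹)
open import Data.Nat.Properties
open import Data.Nat.DivMod using (/-monoˡ-≤; m*n/n≡m)
open import Data.Nat.Tactic.RingSolver using (solve-∀)
open import Algebra.Properties.CommutativeSemigroup +-commutativeSemigroup using (interchange)
open import Data.Fin using (Fin; zero; suc; toℕ; combine; remQuot; _↑ˡ_; _↑ʳ_; inject₁; lower₁)
open import Data.Fin.Properties using (remQuot-combine; combine-remQuot; toℕ-inject₁; toℕ-lower₁)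
  renaming (_≟_ to _≟ᶠ_)
open import Data.Product using (Σ-syntax; _×_; _,_; proj₁; uncurry)
open import Data.Product.Properties using (,-injectiveˡ; ,-injectiveʳ)
open import Data.Sum using (_⊎_; inj₁; inj₂; [_,_])
open import Function using (_∘_)
open import Relation.Nullary using (yes; no; contradiction)
open import Relation.Binary.PropositionalEquality
  using (_≡_; _≢_; _≗_; refl; sym; trans; cong; cong₂; subst; subst₂; module ≡-Reasoning)

∑-cong : ∀ k {u v : Fin k → ℕ} → u ≗ v → ∑ k u ≡ ∑ k v
∑-cong zero    u≗v = refl
∑-cong (suc k) u≗v = cong₂ _+_ (u≗v zero) (∑-cong k (u≗v ∘ suc))

∑-zero : ∀ k → ∑ k (λ _ → 0) ≡ 0
∑-zero zero    = refl
∑-zero (suc k) = ∑-zero k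

∑-distrib-+ : ∀ k (u v : Fin k → ℕ) → ∑ k (λ i → u i + v i) ≡ ∑ k u + ∑ k v
∑-distrib-+ zero    u v = refl
∑-distrib-+ (suc k) u v =
  trans (cong (u zero + v zero +_) (∑-distrib-+ k (u ∘ suc) (v ∘ suc)))
        (interchange (u zero) (v zero) _ _)

∑-distribˡ-* : ∀ k c (u : Fin k → ℕ) → ∑ k (λ i → c * u i) ≡ c * ∑ k u
∑-distribˡ-* zero    c u = sym (*-zeroʳ c)
∑-distribˡ-* (suc k) c u =
  trans (cong (c * u zero +_) (∑-distribˡ-* k c (u ∘ suc))) (sym (*-distribˡ-+ c (u zero) _))

∑-splitAt : ∀ k l (u : Fin (k + l) → ℕ) → ∑ (k + l) u ≡ ∑ k (u ∘ (_↑ˡ l)) + ∑ l (u ∘ (k ↑ʳ_))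
∑-splitAt zero    l u = refl
∑-splitAt (suc k) l u =
  trans (cong (u zero +_) (∑-splitAt k l (u ∘ suc))) (sym (+-assoc (u zero) _ _))

∑-combine : ∀ m n (u : Fin (m * n) → ℕ) → ∑ (m * n) u ≡ ∑ m (λ i → ∑ n (λ j → u (combine i j)))
∑-combine zero    n u = refl
∑-combine (suc m) n u =
  trans (∑-splitAt n (m * n) u) (cong (∑ n (u ∘ (_↑ˡ m * n)) +_) (∑-combine m n (u ∘ (n ↑ʳ_))))

term≤∑ : ∀ {k} (u : Fin k → ℕ) i → u i ≤ ∑ k u
term≤∑ u zero    = m≤m+n _ _
term≤∑ u (suc i) = ≤-trans (term≤∑ (u ∘ suc) i) (m≤n+m _ _)

twoTerms≤∑ : ∀ {k} (u : Fin k → ℕ) {i j} → i ≢ j → u i + u j ≤ ∑ k u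
twoTerms≤∑ u {zero}  {zero}  i≢j = contradiction refl i≢j
twoTerms≤∑ u {zero}  {suc j} _   = +-monoʳ-≤ (u zero) (term≤∑ (u ∘ suc) j)
twoTerms≤∑ u {suc i} {zero}  _   =
  ≤-trans (≤-reflexive (+-comm (u (suc i)) (u zero))) (+-monoʳ-≤ (u zero) (term≤∑ (u ∘ suc) i))
twoTerms≤∑ u {suc i} {suc j} i≢j = ≤-trans (twoTerms≤∑ (u ∘ suc) (i≢j ∘ cong suc)) (m≤n+m _ _)

InClosedNbhd : (G : Graph) → Fin (order G) → Fin (order G) → Set
InClosedNbhd G x y = y ≡ x ⊎ Adj G x y

-- The summands of closedNbhdSum are local to a where block of Defs; unification recovers them.
closedNbhdSummands : (G : Graph) (f : Fin (order G) → ℕ) (x : Fin (order G)) →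
                     Σ[ u ∈ (Fin (order G) → ℕ) ] ∑ (order G) u ≡ closedNbhdSum G f x
closedNbhdSummands G f x = _ , refl

closedNbhdSummand-∈ : (G : Graph) (f : Fin (order G) → ℕ) {x y : Fin (order G)} →
                      InClosedNbhd G x y → proj₁ (closedNbhdSummands G f x) y ≡ f y
closedNbhdSummand-∈ G f {x} {y} y∈N[x] with y ≟ᶠ x | adj? G x y
... | yes _   | _        = refl
... | no _    | yes _    = refl
... | no y≢x  | no ¬xy   = contradiction y∈N[x] [ y≢x , ¬xy ]

closedNbhdSum-≥-pair : (G : Graph) (f : Fin (order G) → ℕ) {x y z : Fin (order G)} → y ≢ z →
                       InClosedNbhd G x y → InClosedNbhd G x z → f y + f z ≤ closedNbhdSum G f x
closedNbhdSum-≥-pair G f {x} y≢z y∈N[x] z∈N[x] =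
  subst₂ (λ a b → a + b ≤ closedNbhdSum G f x)
         (closedNbhdSummand-∈ G f y∈N[x]) (closedNbhdSummand-∈ G f z∈N[x])
         (twoTerms≤∑ (proj₁ (closedNbhdSummands G f x)) y≢z)

pathAdj⇒≢ : ∀ {k} {a b : Fin k} → PathAdj a b → a ≢ b
pathAdj⇒≢ (inj₁ a→b) refl = 1+n≢n a→b
pathAdj⇒≢ (inj₂ b→a) refl = 1+n≢n b→a

steps⇒≢ : ∀ {k} {a b c : Fin k} → suc (toℕ a) ≡ toℕ b → suc (toℕ b) ≡ toℕ c → a ≢ c
steps⇒≢ a→b b→c refl = <-asym (≤-reflexive a→b) (≤-reflexive b→c)

inject₁-step : ∀ {n} (k : Fin n) → suc (toℕ (inject₁ k)) ≡ toℕ (suc k)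
inject₁-step k = cong suc (toℕ-inject₁ k)

lower₁-step : ∀ {n} (j : Fin (suc n)) (n≢j : n ≢ toℕ j) → suc (toℕ j) ≡ toℕ (suc (lower₁ j n≢j))
lower₁-step j n≢j = cong suc (sym (toℕ-lower₁ j n≢j))

onGrid : ∀ {m n} → (Fin m × Fin n → ℕ) → Fin (m * n) → ℕ
onGrid {n = n} g = g ∘ remQuot n

weight-onGrid : ∀ m n (g : Fin m × Fin n → ℕ) →
                weight (Grid m n) (onGrid g) ≡ ∑ m (λ i → ∑ n (λ j → g (i , j)))
weight-onGrid m n g =
  trans (∑-combine m n (onGrid g)) (∑-cong m λ i → ∑-cong n λ j → cong g (remQuot-combine i j))

InGridNbhd : ∀ {m n} → Fin m × Fin n → Fin m × Fin n → Set
InGridNbhd {m} {n} p q = q ≡ p ⊎ GridAdj m n p q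

module _ {m n : ℕ} where

  self : {p : Fin m × Fin n} → InGridNbhd p p
  self = inj₁ refl

  vertical : {i i′ : Fin m} {j : Fin n} → PathAdj i i′ → InGridNbhd (i , j) (i′ , j)
  vertical i~i′ = inj₂ (inj₁ (i~i′ , refl))

  horizontal : {i : Fin m} {j j′ : Fin n} → PathAdj j j′ → InGridNbhd (i , j) (i , j′)
  horizontal j~j′ = inj₂ (inj₂ (refl , j~j′))

  remQuot-combine′ : (q : Fin m × Fin n) → remQuot n (uncurry combine q) ≡ q
  remQuot-combine′ (i , j) = remQuot-combine i j

  inGridNbhd⇒inClosedNbhd : {x : Fin (m * n)} {q : Fin m × Fin n} →
                            InGridNbhd (remQuot n x) q → InClosedNbhd (Grid m n) x (uncurry combine q)
  inGridNbhd⇒inClosedNbhd {x} (inj₁ q≡p) =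
    inj₁ (trans (cong (uncurry combine) q≡p) (combine-remQuot {m} n x))
  inGridNbhd⇒inClosedNbhd {x} {q} (inj₂ p~q) =
    inj₂ (subst (GridAdj m n (remQuot n x)) (sym (remQuot-combine′ q)) p~q)

record PairCover {m n} (g : Fin m × Fin n → ℕ) (p : Fin m × Fin n) : Set where
  constructor pairCover
  field
    q q′     : Fin m × Fin n
    q≢q′     : q ≢ q′
    q-near   : InGridNbhd p q
    q′-near  : InGridNbhd p q′
    weight≥2 : 2 ≤ g q + g q′

onGrid-isInt2DomFun : ∀ {m n} (g : Fin m × Fin n → ℕ) →
                      (∀ p → PairCover g p) → IsInt2DomFun (Grid m n) (onGrid g)
onGrid-isInt2DomFun {m} {n} g cover x =
  ≤-trans (subst₂ (λ a b → 2 ≤ a + b) (value q) (value q′) weight≥2)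
          (closedNbhdSum-≥-pair (Grid m n) (onGrid g) combine-≢
             (inGridNbhd⇒inClosedNbhd q-near) (inGridNbhd⇒inClosedNbhd q′-near))
  where
  open PairCover (cover (remQuot n x))
  value : ∀ r → g r ≡ onGrid g (uncurry combine r)
  value r = cong g (sym (remQuot-combine′ r))
  combine-≢ : uncurry combine q ≢ uncurry combine q′
  combine-≢ e = q≢q′ (trans (sym (remQuot-combine′ q))
                            (trans (cong (remQuot n) e) (remQuot-combine′ q′)))

χodd : ℕ → ℕ
χodd 0             = 0
χodd 1             = 1
χodd (suc (suc t)) = χodd t

χodd-0-or-1 : ∀ t → χodd t ≡ 0 ⊎ χodd t ≡ 1
χodd-0-or-1 0             = inj₁ refl
χodd-0-or-1 1             = inj₂ refl
χodd-0-or-1 (suc (suc t)) = χodd-0-or-1 t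

χodd-+-suc : ∀ t → χodd t + χodd (suc t) ≡ 1
χodd-+-suc 0             = refl
χodd-+-suc 1             = refl
χodd-+-suc (suc (suc t)) = χodd-+-suc t

even⇒suc-odd : ∀ t → χodd t ≡ 0 → χodd (suc t) ≡ 1
even⇒suc-odd t even = trans (cong (_+ χodd (suc t)) (sym even)) (χodd-+-suc t)

suc-even⇒odd : ∀ t → χodd (suc t) ≡ 0 → χodd t ≡ 1
suc-even⇒odd t even = begin
  χodd t                   ≡⟨ sym (+-identityʳ (χodd t)) ⟩
  χodd t + 0               ≡⟨ cong (χodd t +_) (sym even) ⟩
  χodd t + χodd (suc t)    ≡⟨ χodd-+-suc t ⟩
  1                        ∎
  where open ≡-Reasoning

pathAdj-even⇒odd : ∀ {k} {j j′ : Fin k} → PathAdj j j′ → χodd (toℕ j) ≡ 0 → χodd (toℕ j′) ≡ 1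
pathAdj-even⇒odd {j = j} (inj₁ j→j′) even =
  subst (λ t → χodd t ≡ 1) j→j′ (even⇒suc-odd (toℕ j) even)
pathAdj-even⇒odd {j′ = j′} (inj₂ j′→j) even =
  suc-even⇒odd (toℕ j′) (subst (λ t → χodd t ≡ 0) (sym j′→j) even)

odds : ℕ → ℕ
odds k = ∑ k (χodd ∘ toℕ)

odds-count : ∀ k → 2 * odds k + χodd k ≡ k
odds-count 0             = refl
odds-count 1             = refl
odds-count (suc (suc k)) = trans (cong (_+ χodd k) (*-suc 2 (odds k))) (cong (2 +_) (odds-count k))

δ : ℕ → ℕ → ℕ
δ zero    zero    = 1
δ zero    (suc t) = 0
δ (suc p) zero    = 0
δ (suc p) (suc t) = δ p t

δ-diag : ∀ p → δ p p ≡ 1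
δ-diag zero    = refl
δ-diag (suc p) = δ-diag p

∑-δ : ∀ k p → p < k → ∑ k (δ p ∘ toℕ) ≡ 1
∑-δ (suc k) zero    _   = cong suc (∑-zero k)
∑-δ (suc k) (suc p) p<k = ∑-δ k p (s<s⁻¹ p<k)

pattern top    = zero
pattern middle = suc zero
pattern bottom = suc (suc zero)

adjacentRow : Fin 3 → Fin 3
adjacentRow top    = middle
adjacentRow middle = top
adjacentRow bottom = middle

adjacentRow-adj : ∀ i → PathAdj i (adjacentRow i)
adjacentRow-adj top    = inj₁ refl
adjacentRow-adj middle = inj₂ refl
adjacentRow-adj bottom = inj₂ refl

middle-near : ∀ {n} (i : Fin 3) {j : Fin n} → InGridNbhd (i , j) (middle , j)
middle-near top    = vertical (inj₁ refl)
middle-near middle = self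
middle-near bottom = vertical (inj₂ refl)

witness : (n : ℕ) → Fin 3 → Fin (suc n) → ℕ
witness n top    j = χodd (toℕ j)
witness n middle j = χodd (toℕ j) + δ 0 (toℕ j) + χodd (suc n) * δ n (toℕ j)
witness n bottom j = χodd (toℕ j)

χodd≤witness : ∀ n i j → χodd (toℕ j) ≤ witness n i j
χodd≤witness n top    j = ≤-refl
χodd≤witness n middle j = ≤-trans (m≤m+n _ _) (m≤m+n _ _)
χodd≤witness n bottom j = ≤-refl

witness-odd-column : ∀ n i j → χodd (toℕ j) ≡ 1 → 1 ≤ witness n i j
witness-odd-column n i j odd = subst (_≤ witness n i j) odd (χodd≤witness n i j)

witness-first-middle : ∀ n → 1 ≤ witness n middle zero
witness-first-middle n = s≤s z≤n

witness-last-middle : ∀ n {j} → toℕ j ≡ n → χodd n ≡ 0 → 1 ≤ witness n middle j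
witness-last-middle n {j} j≡n even =
  ≤-trans (≤-reflexive (sym extra≡1)) (m≤n+m _ (χodd (toℕ j) + δ 0 (toℕ j)))
  where
  extra≡1 : χodd (suc n) * δ n (toℕ j) ≡ 1
  extra≡1 = cong₂ _*_ (even⇒suc-odd n even) (trans (cong (δ n) j≡n) (δ-diag n))

witness-single-column : ∀ i → 2 ≤ witness 0 i zero + witness 0 (adjacentRow i) zero
witness-single-column top    = ≤-refl
witness-single-column middle = ≤-refl
witness-single-column bottom = ≤-refl

WitnessCover : (n : ℕ) → Fin 3 × Fin (suc n) → Set
WitnessCover n = PairCover (uncurry (witness n))

vertical-cover : ∀ n i j → 2 ≤ witness n i j + witness n (adjacentRow i) j → WitnessCover n (i , j)
vertical-cover n i j enough =
  pairCover (i , j) (adjacentRow i , j) (pathAdj⇒≢ (adjacentRow-adj i) ∘ ,-injectiveˡ)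
            self (vertical (adjacentRow-adj i)) enough

even-column-cover : ∀ n i j → χodd (toℕ j) ≡ 0 → WitnessCover n (i , j)
even-column-cover zero    i zero    even = vertical-cover 0 i zero (witness-single-column i)
even-column-cover (suc m) i zero    _    =
  pairCover (middle , zero) (i , suc zero) (λ ()) (middle-near i) (horizontal (inj₁ refl))
            (+-mono-≤ (witness-first-middle (suc m)) (witness-odd-column (suc m) i (suc zero) refl))
even-column-cover n       i (suc k) even with n ≟ toℕ (suc k)
... | yes n≡j =
  pairCover (middle , suc k) (i , inject₁ k) (pathAdj⇒≢ j~left ∘ ,-injectiveʳ)
            (middle-near i) (horizontal j~left)
            (+-mono-≤ (witness-last-middle n (sym n≡j) (trans (cong χodd n≡j) even))
                      (witness-odd-column n i (inject₁ k) (pathAdj-even⇒odd j~left even)))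
  where
  j~left : PathAdj (suc k) (inject₁ k)
  j~left = inj₂ (inject₁-step k)
... | no n≢j =
  pairCover (i , inject₁ k) (i , right)
            (steps⇒≢ (inject₁-step k) (lower₁-step (suc k) n≢j) ∘ ,-injectiveʳ)
            (horizontal j~left) (horizontal j~right)
            (+-mono-≤ (witness-odd-column n i (inject₁ k) (pathAdj-even⇒odd j~left even))
                      (witness-odd-column n i right (pathAdj-even⇒odd j~right even)))
  where
  right : Fin (suc n)
  right = suc (lower₁ (suc k) n≢j)
  j~left : PathAdj (suc k) (inject₁ k)
  j~left = inj₂ (inject₁-step k)
  j~right : PathAdj (suc k) right
  j~right = inj₁ (lower₁-step (suc k) n≢j)

witness-cover : ∀ n p → WitnessCover n p
witness-cover n (i , j) with χodd-0-or-1 (toℕ j)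
... | inj₁ even = even-column-cover n i j even
... | inj₂ odd  = vertical-cover n i j
                    (+-mono-≤ (witness-odd-column n i j odd) (witness-odd-column n (adjacentRow i) j odd))

middle-row-sum : ∀ n → ∑ (suc n) (witness n middle) ≡ odds (suc n) + 1 + χodd (suc n)
middle-row-sum n = begin
  ∑ N (λ j → χodd (toℕ j) + δ 0 (toℕ j) + c * δ n (toℕ j))
    ≡⟨ ∑-distrib-+ N (λ j → χodd (toℕ j) + δ 0 (toℕ j)) (λ j → c * δ n (toℕ j)) ⟩
  ∑ N (λ j → χodd (toℕ j) + δ 0 (toℕ j)) + ∑ N (λ j → c * δ n (toℕ j))
    ≡⟨ cong₂ _+_ (∑-distrib-+ N (χodd ∘ toℕ) (δ 0 ∘ toℕ)) (∑-distribˡ-* N c (δ n ∘ toℕ)) ⟩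
  odds N + ∑ N (δ 0 ∘ toℕ) + c * ∑ N (δ n ∘ toℕ)
    ≡⟨ cong₂ (λ a b → odds N + a + c * b) (∑-δ N 0 (s≤s z≤n)) (∑-δ N n ≤-refl) ⟩
  odds N + 1 + c * 1
    ≡⟨ cong (odds N + 1 +_) (*-identityʳ c) ⟩
  odds N + 1 + c
    ∎
  where
  open ≡-Reasoning
  N c : ℕ
  N = suc n
  c = χodd (suc n)

witness-weight : ∀ n → weight (Grid 3 (suc n)) (onGrid (uncurry (witness n))) ≡
                       3 * odds (suc n) + χodd (suc n) + 1
witness-weight n = begin
  weight (Grid 3 (suc n)) (onGrid (uncurry (witness n)))
    ≡⟨ weight-onGrid 3 (suc n) (uncurry (witness n)) ⟩
  o + (∑ (suc n) (witness n middle) + (o + 0))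
    ≡⟨ cong (λ s → o + (s + (o + 0))) (middle-row-sum n) ⟩
  o + ((o + 1 + c) + (o + 0))
    ≡⟨ rows-total o c ⟩
  3 * o + c + 1
    ∎
  where
  open ≡-Reasoning
  o c : ℕ
  o = odds (suc n)
  c = χodd (suc n)
  rows-total : ∀ o c → o + ((o + 1 + c) + (o + 0)) ≡ 3 * o + c + 1
  rows-total = solve-∀

2*m≤n⇒m≤n/2 : ∀ {m n} → 2 * m ≤ n → m ≤ n / 2
2*m≤n⇒m≤n/2 {m} {n} 2m≤n = begin
  m           ≡⟨ m*n/n≡m m 2 ⟨
  m * 2 / 2   ≤⟨ /-monoˡ-≤ 2 (≤-trans (≤-reflexive (*-comm m 2)) 2m≤n) ⟩
  n / 2       ∎
  where open ≤-Reasoning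

3m+n≤3[2m+n]/2 : ∀ m n → 3 * m + n ≤ 3 * (2 * m + n) / 2
3m+n≤3[2m+n]/2 m n = 2*m≤n⇒m≤n/2 (begin
  2 * (3 * m + n)       ≤⟨ m≤m+n _ n ⟩
  2 * (3 * m + n) + n   ≡⟨ expand m n ⟩
  3 * (2 * m + n)       ∎)
  where
  open ≤-Reasoning
  expand : ∀ m n → 2 * (3 * m + n) + n ≡ 3 * (2 * m + n)
  expand = solve-∀

theorem2p4 : (n : ℕ) → γ₂-≤ (Grid 3 (suc n)) ((3 * suc n) / 2 + 1)
theorem2p4 n = onGrid (uncurry (witness n)) , onGrid-isInt2DomFun _ (witness-cover n) , (begin
  weight (Grid 3 N) (onGrid (uncurry (witness n)))   ≡⟨ witness-weight n ⟩
  3 * odds N + χodd N + 1                           ≤⟨ +-monoˡ-≤ 1 (3m+n≤3[2m+n]/2 (odds N) (χodd N)) ⟩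
  3 * (2 * odds N + χodd N) / 2 + 1                 ≡⟨ cong (λ k → 3 * k / 2 + 1) (odds-count N) ⟩
  3 * N / 2 + 1                                     ∎)
  where
  open ≤-Reasoning
  N : ℕ
  N = suc n
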